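{- Let $t$ be a positive integer, $\sqrt{ -t}=i\sqrt t$, let $r$ be a positive integer and $g\in\{0,1\}$. Let $$A_{r, g} (z) = \sum_{m =0}^{r}{r - g + \frac{1}{4} \choose m} {2r - g - m \choose r - g} (-z)^{m}, \qquad B_{r, g} (z) = \sum_{m =0}^{r-g}{r - \frac{1}{4} \choose m} {2r - g - m \choose r } (-z)^{m},$$ and for a polynomial $Q(z)$ of degree $n$ let $Q^{*}(x,y) = x^{n}Q(y/x)$ be the associated binary form (so $A_{r,g}^*$ has degree $r$ and $B_{r,g}^*$ has degree $r-g$). Let $\xi(x,y),\eta(x,y)$ be linear forms with complex coefficients satisfying identically $$\xi(x,y)^{4} = 4 (\sqrt{ -t}+1)(x - \sqrt{ -t}\,y)^{4}, \qquad \eta(x,y)^{4} = 4 (\sqrt{ -t}-1 )(x + \sqrt{ -t}\,y)^{4}.$$ Then for any pair of rational integers $(x , y)$, both $$A^{*}_{r,g}\big(\xi^{4}(x , y),\ \xi^{4}(x , y) -\eta^{4}(x , y)\big) \quad\text{and}\quad B^{*}_{r,g}\big(\xi^{4}(x , y),\ \xi^{4}(x , y) -\eta^{4}(x , y) \big)$$ are algebraic integers in $\mathbb{Q}(\sqrt{ -t})$.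
   Context: ${a \choose m}$ denotes the generalized binomial coefficient $a(a-1)\cdots(a-m+1)/m!$. Note $\xi^4(x,y)-\eta^4(x,y) = 8P(x,y)$ with $P(x , y) = x^{4} + 4tx^{3}y -6tx^{2}y^{2} - 4t^{2}xy^{3} + t^{2}y^{4}$. -}

module Defs where

open import Data.Nat as ℕ using (ℕ; zero; suc; _∸_)
open import Data.Nat.Combinatorics using (_C_)
open import Data.Integer as ℤ using (ℤ; +_)
open import Data.Rational as ℚ using (ℚ; _/_; 0ℚ; 1ℚ)
open import Data.Product using (_×_; _,_; ∃)
open import Data.List using (List; _∷_; foldl)
open import Relation.Binary.PropositionalEquality using (_≡_)

ℤ→ℚ : ℤ → ℚ
ℤ→ℚ z = z / 1

ℕ→ℚ : ℕ → ℚ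
ℕ→ℚ n = (+ n) / 1

gbinom : ℚ → ℕ → ℚ
gbinom a zero    = 1ℚ
gbinom a (suc m) = gbinom a m ℚ.* ((a ℚ.- ℕ→ℚ m) ℚ.* ((+ 1) / suc m))

-- The field Q(√-t) = Q[s]/(s² + t), elements a + b·s stored as (a , b).
-- (For t ≥ 1, -t is never a rational square, so this is a field, and s
-- plays the role of √-t = i√t.)

K : Set
K = ℚ × ℚ

0K : K
0K = 0ℚ , 0ℚ

1K : K
1K = 1ℚ , 0ℚ

ℚ→K : ℚ → K
ℚ→K q = q , 0ℚ

ℤ→K : ℤ → K
ℤ→K z = ℚ→K (ℤ→ℚ z)

sK : K
sK = 0ℚ , 1ℚ

module _ (t : ℕ) where

  infixl 6 _+K_ _-K_
  infixl 7 _*K_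

  _+K_ : K → K → K
  (a , b) +K (c , d) = (a ℚ.+ c) , (b ℚ.+ d)

  -K_ : K → K
  -K (a , b) = ℚ.- a , ℚ.- b

  _-K_ : K → K → K
  x -K y = x +K (-K y)

  _*K_ : K → K → K
  (a , b) *K (c , d) =
    (a ℚ.* c ℚ.- ℕ→ℚ t ℚ.* (b ℚ.* d)) , (a ℚ.* d ℚ.+ b ℚ.* c)

  _^K_ : K → ℕ → K
  x ^K zero  = 1K
  x ^K suc n = x *K (x ^K n)

  sumK : ℕ → (ℕ → K) → K
  sumK zero    f = f 0
  sumK (suc n) f = sumK n f +K f (suc n)

  -- Binary form Q*(X,Y) = X^n Q(Y/X) attached to Q(z) = Σ_{m=0}^{n} c_m z^m,
  -- i.e.  Q*(X,Y) = Σ_{m=0}^{n} c_m Y^m X^(n-m).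
  homog : ℕ → (ℕ → ℚ) → K → K → K
  homog n c X Y = sumK n (λ m → ℚ→K (c m) *K (Y ^K m) *K (X ^K (n ∸ m)))

  -- Evaluation of the monic integer polynomial
  --   z^n + c₁ z^(n-1) + ... + cₙ   (cs = c₁ ∷ ... ∷ cₙ ∷ [])
  -- at α, by Horner's scheme.
  evalMonic : List ℤ → K → K
  evalMonic cs α = foldl (λ acc c → acc *K α +K ℤ→K c) 1K cs

  IsAlgebraicInteger : K → Set
  IsAlgebraicInteger α = ∃ λ (cs : List ℤ) → evalMonic cs α ≡ 0K

  ξ⁴ : ℤ → ℤ → K
  ξ⁴ x y = ℤ→K (+ 4) *K (sK +K 1K) *K ((ℤ→K x -K sK *K ℤ→K y) ^K 4)

  η⁴ : ℤ → ℤ → K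
  η⁴ x y = ℤ→K (+ 4) *K (sK -K 1K) *K ((ℤ→K x +K sK *K ℤ→K y) ^K 4)

negOnePow : ℕ → ℚ
negOnePow zero    = 1ℚ
negOnePow (suc m) = ℚ.- negOnePow m

coeffA : ℕ → ℕ → ℕ → ℚ
coeffA r g m =
  gbinom (ℕ→ℚ (r ∸ g) ℚ.+ ((+ 1) / 4)) m
    ℚ.* ℕ→ℚ ((2 ℕ.* r ∸ g ∸ m) C (r ∸ g)) ℚ.* negOnePow m

coeffB : ℕ → ℕ → ℕ → ℚ
coeffB r g m =
  gbinom (ℕ→ℚ r ℚ.- ((+ 1) / 4)) m
    ℚ.* ℕ→ℚ ((2 ℕ.* r ∸ g ∸ m) C r) ℚ.* negOnePow m

A* : (t r g : ℕ) → K → K → K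
A* t r g = homog t r (coeffA r g)

B* : (t r g : ℕ) → K → K → K
B* t r g = homog t (r ∸ g) (coeffB r g)

{-# OPTIONS --safe #-}

-- We have ξ⁴ = 4W and ξ⁴ - η⁴ = 8P with W = (√-t + 1)(x - √-t y)⁴ ∈ ℤ[√-t] and P ∈ ℤ, so the
-- term cₘ (8P)ᵐ (4W)ⁿ⁻ᵐ of either binary form lies in ℤ[√-t] once 8ᵐ cₘ ∈ ℤ, and every element
-- a + b√-t of ℤ[√-t] is an algebraic integer.  Up to integer factors the coefficients are
-- binom(k + 1/4, m) and binom(k + 3/4, m) with k ∈ ℕ.  By Vandermonde's identity (proved for
-- rational upper arguments), integrality of 8ᵐ binom(a, m) for all m is preserved under
-- a ↦ a + b whenever it holds for b; this reduces everything to a = 1/4 and a = 1/2.  For these,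
-- Vandermonde gives (8ᵐ binom(1/4, m))ₘ ⋆ (8ᵐ binom(1/4, m))ₘ = (2ᵐ · 4ᵐ binom(1/2, m))ₘ and
-- (4ᵐ binom(1/2, m))ₘ ⋆ (4ᵐ binom(1/2, m))ₘ = (4ᵐ binom(1, m))ₘ, and a sequence 1, w₁, w₂, … with w₁
-- even whose Cauchy square vanishes mod 4 from index 2 on has all its terms integral.

module Submission where

open import Defs
open import Data.Nat as ℕ using (ℕ; zero; suc; _∸_; _≤_; z≤n; s≤s)
import Data.Nat.Properties as ℕP
open import Data.Nat.Combinatorics using (_C_)
open import Data.Nat.Coprimality as Coprime using (1-coprimeTo)
open import Data.Integer as ℤ using (ℤ; +_; -[1+_])
import Data.Integer.Properties as ℤP
open import Data.Rational as ℚ using (ℚ; mkℚ; _/_; 0ℚ; 1ℚ)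
import Data.Rational.Properties as ℚP
open import Data.Rational.Solver using (module +-*-Solver)
open import Algebra.Bundles using (CommutativeRing)
open import Algebra.Definitions.RawSemiring ℚP.+-*-rawSemiring using (_^_)
open import Algebra.Properties.CommutativeSemiring.Exp
  (CommutativeRing.commutativeSemiring ℚP.+-*-commutativeRing) using (^-distrib-*)
open import Data.Product using (∃; _×_; _,_; proj₁; proj₂)
open import Data.List using ([]; _∷_)
open import Data.Sum using (inj₁; inj₂)
open import Function using (_∘_)
open import Relation.Binary.PropositionalEquality
open +-*-Solver
open ≡-Reasoning

Integral : ℚ → Set
Integral q = ∃ λ z → q ≡ ℤ→ℚ z

private
  fromℤ : ℤ → ℚ
  fromℤ z = mkℚ z 0 (Coprime.sym (1-coprimeTo ℤ.∣ z ∣))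

  ℤ→ℚ≡fromℤ : ∀ z → ℤ→ℚ z ≡ fromℤ z
  ℤ→ℚ≡fromℤ z = ℚP.↥p/↧p≡p (fromℤ z)

ℤ→ℚ-homo-+ : ∀ a b → ℤ→ℚ (a ℤ.+ b) ≡ ℤ→ℚ a ℚ.+ ℤ→ℚ b
ℤ→ℚ-homo-+ a b rewrite ℤ→ℚ≡fromℤ a | ℤ→ℚ≡fromℤ b =
  cong (_/ 1) (cong₂ ℤ._+_ (sym (ℤP.*-identityʳ a)) (sym (ℤP.*-identityʳ b)))

ℤ→ℚ-homo-* : ∀ a b → ℤ→ℚ (a ℤ.* b) ≡ ℤ→ℚ a ℚ.* ℤ→ℚ b
ℤ→ℚ-homo-* a b rewrite ℤ→ℚ≡fromℤ a | ℤ→ℚ≡fromℤ b = refl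

ℤ→ℚ-homo-neg : ∀ a → ℤ→ℚ (ℤ.- a) ≡ ℚ.- ℤ→ℚ a
ℤ→ℚ-homo-neg a rewrite ℤ→ℚ≡fromℤ a | ℤ→ℚ≡fromℤ (ℤ.- a) = fromℤ-neg a
  where
  fromℤ-neg : ∀ a → fromℤ (ℤ.- a) ≡ ℚ.- fromℤ a
  fromℤ-neg (+ zero)  = refl
  fromℤ-neg (+ suc n) = refl
  fromℤ-neg -[1+ n ]  = refl

ℕ→ℚ-suc : ∀ n → ℕ→ℚ (suc n) ≡ 1ℚ ℚ.+ ℕ→ℚ n
ℕ→ℚ-suc n = ℤ→ℚ-homo-+ (+ 1) (+ n)

ℕ→ℚ-suc-*-inverse : ∀ m → ℕ→ℚ (suc m) ℚ.* ((+ 1) / suc m) ≡ 1ℚ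
ℕ→ℚ-suc-*-inverse m = begin
  ℕ→ℚ (suc m) ℚ.* ((+ 1) / suc m)
    ≡⟨ cong₂ ℚ._*_ (ℤ→ℚ≡fromℤ (+ suc m)) (ℚP.↥p/↧p≡p (mkℚ (+ 1) m (1-coprimeTo (suc m)))) ⟩
  fromℤ (+ suc m) ℚ.* ℚ.1/ fromℤ (+ suc m)
    ≡⟨ ℚP.*-inverseʳ (fromℤ (+ suc m)) ⟩
  1ℚ ∎

ℕ→ℚ-suc-*-cancelˡ : ∀ m {a b} → ℕ→ℚ (suc m) ℚ.* a ≡ ℕ→ℚ (suc m) ℚ.* b → a ≡ b
ℕ→ℚ-suc-*-cancelˡ m {a} {b} eq = begin
  a                       ≡⟨ sym (undo a) ⟩
  I ℚ.* (N ℚ.* a)         ≡⟨ cong (I ℚ.*_) eq ⟩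
  I ℚ.* (N ℚ.* b)         ≡⟨ undo b ⟩
  b                       ∎
  where
  N = ℕ→ℚ (suc m)
  I = (+ 1) / suc m
  undo : ∀ c → I ℚ.* (N ℚ.* c) ≡ c
  undo c = begin
    I ℚ.* (N ℚ.* c)  ≡⟨ solve 3 (λ i n c → i :* (n :* c) := (n :* i) :* c) refl I N c ⟩
    (N ℚ.* I) ℚ.* c  ≡⟨ cong (ℚ._* c) (ℕ→ℚ-suc-*-inverse m) ⟩
    1ℚ ℚ.* c         ≡⟨ ℚP.*-identityˡ c ⟩
    c                ∎

integral-ℤ : ∀ z → Integral (ℤ→ℚ z)
integral-ℤ z = z , refl

integral-ℕ : ∀ n → Integral (ℕ→ℚ n)
integral-ℕ n = + n , refl

integral-+ : ∀ {p q} → Integral p → Integral q → Integral (p ℚ.+ q)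
integral-+ (a , refl) (b , refl) = a ℤ.+ b , sym (ℤ→ℚ-homo-+ a b)

integral-* : ∀ {p q} → Integral p → Integral q → Integral (p ℚ.* q)
integral-* (a , refl) (b , refl) = a ℤ.* b , sym (ℤ→ℚ-homo-* a b)

integral-neg : ∀ {p} → Integral p → Integral (ℚ.- p)
integral-neg (a , refl) = ℤ.- a , sym (ℤ→ℚ-homo-neg a)

integral-sub : ∀ {p q} → Integral p → Integral q → Integral (p ℚ.- q)
integral-sub ip iq = integral-+ ip (integral-neg iq)

integral-^ : ∀ {q} → Integral q → ∀ k → Integral (q ^ k)
integral-^ iq zero    = integral-ℤ (+ 1)
integral-^ iq (suc k) = integral-* iq (integral-^ iq k)

integral-negOnePow : ∀ m → Integral (negOnePow m)
integral-negOnePow zero    = integral-ℤ (+ 1)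
integral-negOnePow (suc m) = integral-neg (integral-negOnePow m)

MultipleOf : ℚ → ℚ → Set
MultipleOf c q = ∃ λ h → Integral h × q ≡ c ℚ.* h

integral-multipleOf : ∀ {c q} → Integral c → MultipleOf c q → Integral q
integral-multipleOf integral-c (h , integral-h , refl) = integral-* integral-c integral-h

two four eight half quarter : ℚ
two     = ℤ→ℚ (+ 2)
four    = ℤ→ℚ (+ 4)
eight   = ℤ→ℚ (+ 8)
half    = (+ 1) / 2
quarter = (+ 1) / 4

-- conv f g m = Σ_{i+j=m} f i * g j, the Cauchy product of coefficient sequences.
conv : (ℕ → ℚ) → (ℕ → ℚ) → ℕ → ℚ
conv f g zero    = f 0 ℚ.* g 0
conv f g (suc m) = f 0 ℚ.* g (suc m) ℚ.+ conv (f ∘ suc) g m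

conv-cong : ∀ {f f′ g g′} → (∀ i → f i ≡ f′ i) → (∀ j → g j ≡ g′ j) →
            ∀ m → conv f g m ≡ conv f′ g′ m
conv-cong f≗f′ g≗g′ zero    = cong₂ ℚ._*_ (f≗f′ 0) (g≗g′ 0)
conv-cong f≗f′ g≗g′ (suc m) =
  cong₂ ℚ._+_ (cong₂ ℚ._*_ (f≗f′ 0) (g≗g′ (suc m))) (conv-cong (f≗f′ ∘ suc) g≗g′ m)

conv-distribʳ-+ : ∀ f h g m → conv (λ i → f i ℚ.+ h i) g m ≡ conv f g m ℚ.+ conv h g m
conv-distribʳ-+ f h g zero = solve 3 (λ a b c → (a :+ b) :* c := a :* c :+ b :* c) refl (f 0) (h 0) (g 0)
conv-distribʳ-+ f h g (suc m) = begin
  (f 0 ℚ.+ h 0) ℚ.* g (suc m) ℚ.+ conv (λ i → f (suc i) ℚ.+ h (suc i)) g m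
    ≡⟨ cong ((f 0 ℚ.+ h 0) ℚ.* g (suc m) ℚ.+_) (conv-distribʳ-+ (f ∘ suc) (h ∘ suc) g m) ⟩
  (f 0 ℚ.+ h 0) ℚ.* g (suc m) ℚ.+ (conv (f ∘ suc) g m ℚ.+ conv (h ∘ suc) g m)
    ≡⟨ solve 5 (λ a b c x y → (a :+ b) :* c :+ (x :+ y) := (a :* c :+ x) :+ (b :* c :+ y))
         refl (f 0) (h 0) (g (suc m)) (conv (f ∘ suc) g m) (conv (h ∘ suc) g m) ⟩
  conv f g (suc m) ℚ.+ conv h g (suc m) ∎

conv-*ˡ : ∀ c f g m → conv (λ i → c ℚ.* f i) g m ≡ c ℚ.* conv f g m
conv-*ˡ c f g zero = solve 3 (λ c a b → (c :* a) :* b := c :* (a :* b)) refl c (f 0) (g 0)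
conv-*ˡ c f g (suc m) = begin
  c ℚ.* f 0 ℚ.* g (suc m) ℚ.+ conv (λ i → c ℚ.* f (suc i)) g m
    ≡⟨ cong (c ℚ.* f 0 ℚ.* g (suc m) ℚ.+_) (conv-*ˡ c (f ∘ suc) g m) ⟩
  c ℚ.* f 0 ℚ.* g (suc m) ℚ.+ c ℚ.* conv (f ∘ suc) g m
    ≡⟨ solve 4 (λ c a b x → c :* a :* b :+ c :* x := c :* (a :* b :+ x))
         refl c (f 0) (g (suc m)) (conv (f ∘ suc) g m) ⟩
  c ℚ.* conv f g (suc m) ∎

conv-last : ∀ f g m → conv f g (suc m) ≡ conv f (g ∘ suc) m ℚ.+ f (suc m) ℚ.* g 0
conv-last f g zero    = refl
conv-last f g (suc m) = begin
  f 0 ℚ.* g (2 ℕ.+ m) ℚ.+ conv (f ∘ suc) g (suc m)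
    ≡⟨ cong (f 0 ℚ.* g (2 ℕ.+ m) ℚ.+_) (conv-last (f ∘ suc) g m) ⟩
  f 0 ℚ.* g (2 ℕ.+ m) ℚ.+ (conv (f ∘ suc) (g ∘ suc) m ℚ.+ f (2 ℕ.+ m) ℚ.* g 0)
    ≡⟨ sym (ℚP.+-assoc (f 0 ℚ.* g (2 ℕ.+ m)) (conv (f ∘ suc) (g ∘ suc) m) (f (2 ℕ.+ m) ℚ.* g 0)) ⟩
  conv f (g ∘ suc) (suc m) ℚ.+ f (2 ℕ.+ m) ℚ.* g 0 ∎

conv-^ : ∀ c f g m → conv (λ i → c ^ i ℚ.* f i) (λ j → c ^ j ℚ.* g j) m ≡ c ^ m ℚ.* conv f g m
conv-^ c f g zero = solve 2 (λ a b → (con 1ℚ :* a) :* (con 1ℚ :* b) := con 1ℚ :* (a :* b)) refl (f 0) (g 0)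
conv-^ c f g (suc m) = begin
  1ℚ ℚ.* f 0 ℚ.* (c ^ suc m ℚ.* g (suc m)) ℚ.+ conv (λ i → c ℚ.* c ^ i ℚ.* f (suc i)) (λ j → c ^ j ℚ.* g j) m
    ≡⟨ cong (1ℚ ℚ.* f 0 ℚ.* (c ^ suc m ℚ.* g (suc m)) ℚ.+_) (begin
         conv (λ i → c ℚ.* c ^ i ℚ.* f (suc i)) (λ j → c ^ j ℚ.* g j) m
           ≡⟨ conv-cong (λ i → ℚP.*-assoc c (c ^ i) (f (suc i))) (λ _ → refl) m ⟩
         conv (λ i → c ℚ.* (c ^ i ℚ.* f (suc i))) (λ j → c ^ j ℚ.* g j) m
           ≡⟨ conv-*ˡ c (λ i → c ^ i ℚ.* f (suc i)) (λ j → c ^ j ℚ.* g j) m ⟩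
         c ℚ.* conv (λ i → c ^ i ℚ.* f (suc i)) (λ j → c ^ j ℚ.* g j) m
           ≡⟨ cong (c ℚ.*_) (conv-^ c (f ∘ suc) g m) ⟩
         c ℚ.* (c ^ m ℚ.* conv (f ∘ suc) g m) ∎) ⟩
  1ℚ ℚ.* f 0 ℚ.* (c ^ suc m ℚ.* g (suc m)) ℚ.+ c ℚ.* (c ^ m ℚ.* conv (f ∘ suc) g m)
    ≡⟨ solve 5 (λ c p a b x → con 1ℚ :* a :* ((c :* p) :* b) :+ c :* (p :* x) := (c :* p) :* (a :* b :+ x))
         refl c (c ^ m) (f 0) (g (suc m)) (conv (f ∘ suc) g m) ⟩
  c ^ suc m ℚ.* conv f g (suc m) ∎

integral-conv : ∀ {f g} → (∀ i → Integral (f i)) → (∀ j → Integral (g j)) → ∀ m → Integral (conv f g m)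
integral-conv if ig zero    = integral-* (if 0) (ig 0)
integral-conv if ig (suc m) = integral-+ (integral-* (if 0) (ig (suc m))) (integral-conv (if ∘ suc) ig m)

multipleOf-* : ∀ {c d p q} → MultipleOf c p → MultipleOf d q → MultipleOf (c ℚ.* d) (p ℚ.* q)
multipleOf-* {c} {d} (h , ih , refl) (h′ , ih′ , refl) =
  h ℚ.* h′ , integral-* ih ih′ , solve 4 (λ c d a b → (c :* a) :* (d :* b) := (c :* d) :* (a :* b)) refl c d h h′

multipleOf-+ : ∀ {c p q} → MultipleOf c p → MultipleOf c q → MultipleOf c (p ℚ.+ q)
multipleOf-+ {c} (h , ih , refl) (h′ , ih′ , refl) =
  h ℚ.+ h′ , integral-+ ih ih′ , solve 3 (λ c a b → c :* a :+ c :* b := c :* (a :+ b)) refl c h h′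

multipleOf-conv : ∀ {c d} k f g → (∀ i → i ≤ k → MultipleOf c (f i)) → (∀ j → j ≤ k → MultipleOf d (g j)) →
                  MultipleOf (c ℚ.* d) (conv f g k)
multipleOf-conv {c} {d} zero    f g mf mg = multipleOf-* {c} {d} (mf 0 z≤n) (mg 0 z≤n)
multipleOf-conv {c} {d} (suc k) f g mf mg = multipleOf-+ {c ℚ.* d}
  (multipleOf-* {c} {d} (mf 0 z≤n) (mg (suc k) ℕP.≤-refl))
  (multipleOf-conv {c} {d} k (f ∘ suc) g (λ i i≤k → mf (suc i) (s≤s i≤k)) (λ j j≤k → mg j (ℕP.m≤n⇒m≤1+n j≤k)))

derivative : (ℕ → ℚ) → ℕ → ℚ
derivative f i = ℕ→ℚ (suc i) ℚ.* f (suc i)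

derivative-conv : ∀ f g m → derivative (conv f g) m ≡ conv (derivative f) g m ℚ.+ conv f (derivative g) m
derivative-conv f g zero = solve 4 (λ a b c d → con 1ℚ :* (a :* b :+ c :* d) := (con 1ℚ :* c) :* d :+ a :* (con 1ℚ :* b))
  refl (f 0) (g 1) (f 1) (g 0)
derivative-conv f g (suc m) = begin
  ℕ→ℚ (2 ℕ.+ m) ℚ.* (f₀ ℚ.* G ℚ.+ (f₁ ℚ.* g₁ ℚ.+ R))
    ≡⟨ cong (ℚ._* (f₀ ℚ.* G ℚ.+ (f₁ ℚ.* g₁ ℚ.+ R))) (ℕ→ℚ-suc (suc m)) ⟩
  (1ℚ ℚ.+ M) ℚ.* (f₀ ℚ.* G ℚ.+ (f₁ ℚ.* g₁ ℚ.+ R))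
    ≡⟨ solve 6 (λ M f₀ G f₁ g₁ R → (con 1ℚ :+ M) :* (f₀ :* G :+ (f₁ :* g₁ :+ R)) :=
          (f₁ :* g₁ :+ R) :+ M :* (f₁ :* g₁ :+ R) :+ f₀ :* ((con 1ℚ :+ M) :* G)) refl M f₀ G f₁ g₁ R ⟩
  (f₁ ℚ.* g₁ ℚ.+ R) ℚ.+ M ℚ.* (f₁ ℚ.* g₁ ℚ.+ R) ℚ.+ f₀ ℚ.* ((1ℚ ℚ.+ M) ℚ.* G)
    ≡⟨ cong₂ (λ u v → (f₁ ℚ.* g₁ ℚ.+ R) ℚ.+ u ℚ.+ f₀ ℚ.* (v ℚ.* G))
         (derivative-conv (f ∘ suc) g m) (sym (ℕ→ℚ-suc (suc m))) ⟩
  (f₁ ℚ.* g₁ ℚ.+ R) ℚ.+ (Df′ ℚ.+ Dg′) ℚ.+ f₀ ℚ.* derivative g (suc m)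
    ≡⟨ solve 6 (λ f₁ g₁ R A B X → (f₁ :* g₁ :+ R) :+ (A :+ B) :+ X := (con 1ℚ :* f₁ :* g₁ :+ (A :+ R)) :+ X :+ B)
         refl f₁ g₁ R Df′ Dg′ (f₀ ℚ.* derivative g (suc m)) ⟩
  (1ℚ ℚ.* f₁ ℚ.* g₁ ℚ.+ (Df′ ℚ.+ R)) ℚ.+ f₀ ℚ.* derivative g (suc m) ℚ.+ Dg′
    ≡⟨ cong (λ u → (1ℚ ℚ.* f₁ ℚ.* g₁ ℚ.+ u) ℚ.+ f₀ ℚ.* derivative g (suc m) ℚ.+ Dg′)
         (sym (trans (conv-cong derivative-suc (λ _ → refl) m)
                     (conv-distribʳ-+ (derivative (f ∘ suc)) (f ∘ suc ∘ suc) g m))) ⟩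
  (1ℚ ℚ.* f₁ ℚ.* g₁ ℚ.+ conv (derivative f ∘ suc) g m) ℚ.+ f₀ ℚ.* derivative g (suc m) ℚ.+ Dg′
    ≡⟨ ℚP.+-assoc (1ℚ ℚ.* f₁ ℚ.* g₁ ℚ.+ conv (derivative f ∘ suc) g m) (f₀ ℚ.* derivative g (suc m)) Dg′ ⟩
  conv (derivative f) g (suc m) ℚ.+ conv f (derivative g) (suc m) ∎
  where
  M   = ℕ→ℚ (suc m)
  f₀  = f 0
  f₁  = f 1
  G   = g (2 ℕ.+ m)
  g₁  = g (suc m)
  R   = conv (f ∘ suc ∘ suc) g m
  Df′ = conv (derivative (f ∘ suc)) g m
  Dg′ = conv (f ∘ suc) (derivative g) m
  derivative-suc : ∀ i → derivative f (suc i) ≡ derivative (f ∘ suc) i ℚ.+ f (2 ℕ.+ i)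
  derivative-suc i = trans (cong (ℚ._* f (2 ℕ.+ i)) (ℕ→ℚ-suc (suc i)))
    (solve 2 (λ n a → (con 1ℚ :+ n) :* a := n :* a :+ a) refl (ℕ→ℚ (suc i)) (f (2 ℕ.+ i)))

conv-falling-weights : ∀ c d f g m →
  conv (λ i → (c ℚ.- ℕ→ℚ i) ℚ.* f i) g m ℚ.+ conv f (λ j → (d ℚ.- ℕ→ℚ j) ℚ.* g j) m
    ≡ (c ℚ.+ d ℚ.- ℕ→ℚ m) ℚ.* conv f g m
conv-falling-weights c d f g zero =
  solve 4 (λ c d f g → (c :- con 0ℚ) :* f :* g :+ f :* ((d :- con 0ℚ) :* g) := (c :+ d :- con 0ℚ) :* (f :* g))
    refl c d (f 0) (g 0)
conv-falling-weights c d f g (suc m) = begin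
  (c ℚ.- 0ℚ) ℚ.* f 0 ℚ.* g (suc m) ℚ.+ conv (λ i → (c ℚ.- ℕ→ℚ (suc i)) ℚ.* f (suc i)) g m
    ℚ.+ (f 0 ℚ.* ((d ℚ.- ℕ→ℚ (suc m)) ℚ.* g (suc m)) ℚ.+ B)
    ≡⟨ cong (λ u → ((c ℚ.- 0ℚ) ℚ.* f 0 ℚ.* g (suc m) ℚ.+ u) ℚ.+ (f 0 ℚ.* ((d ℚ.- ℕ→ℚ (suc m)) ℚ.* g (suc m)) ℚ.+ B))
         (conv-cong shift-weight (λ _ → refl) m) ⟩
  (c ℚ.- 0ℚ) ℚ.* f 0 ℚ.* g (suc m) ℚ.+ A ℚ.+ (f 0 ℚ.* ((d ℚ.- ℕ→ℚ (suc m)) ℚ.* g (suc m)) ℚ.+ B)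
    ≡⟨ cong (λ u → (c ℚ.- 0ℚ) ℚ.* f 0 ℚ.* g (suc m) ℚ.+ A ℚ.+ (f 0 ℚ.* ((d ℚ.- u) ℚ.* g (suc m)) ℚ.+ B))
         (ℕ→ℚ-suc m) ⟩
  (c ℚ.- 0ℚ) ℚ.* f 0 ℚ.* g (suc m) ℚ.+ A ℚ.+ (f 0 ℚ.* ((d ℚ.- (1ℚ ℚ.+ M)) ℚ.* g (suc m)) ℚ.+ B)
    ≡⟨ solve 7 (λ c d f₀ G M A B → (c :- con 0ℚ) :* f₀ :* G :+ A :+ (f₀ :* ((d :- (con 1ℚ :+ M)) :* G) :+ B)
                                 := (c :+ d :- (con 1ℚ :+ M)) :* (f₀ :* G) :+ (A :+ B))
         refl c d (f 0) (g (suc m)) M A B ⟩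
  (c ℚ.+ d ℚ.- (1ℚ ℚ.+ M)) ℚ.* (f 0 ℚ.* g (suc m)) ℚ.+ (A ℚ.+ B)
    ≡⟨ cong ((c ℚ.+ d ℚ.- (1ℚ ℚ.+ M)) ℚ.* (f 0 ℚ.* g (suc m)) ℚ.+_) (conv-falling-weights (c ℚ.- 1ℚ) d (f ∘ suc) g m) ⟩
  (c ℚ.+ d ℚ.- (1ℚ ℚ.+ M)) ℚ.* (f 0 ℚ.* g (suc m)) ℚ.+ ((c ℚ.- 1ℚ) ℚ.+ d ℚ.- M) ℚ.* C
    ≡⟨ solve 6 (λ c d f₀ G M C → (c :+ d :- (con 1ℚ :+ M)) :* (f₀ :* G) :+ ((c :- con 1ℚ) :+ d :- M) :* C
                               := (c :+ d :- (con 1ℚ :+ M)) :* (f₀ :* G :+ C))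
         refl c d (f 0) (g (suc m)) M C ⟩
  (c ℚ.+ d ℚ.- (1ℚ ℚ.+ M)) ℚ.* conv f g (suc m)
    ≡⟨ cong (λ u → (c ℚ.+ d ℚ.- u) ℚ.* conv f g (suc m)) (sym (ℕ→ℚ-suc m)) ⟩
  (c ℚ.+ d ℚ.- ℕ→ℚ (suc m)) ℚ.* conv f g (suc m) ∎
  where
  M = ℕ→ℚ m
  A = conv (λ i → ((c ℚ.- 1ℚ) ℚ.- ℕ→ℚ i) ℚ.* f (suc i)) g m
  B = conv (f ∘ suc) (λ j → (d ℚ.- ℕ→ℚ j) ℚ.* g j) m
  C = conv (f ∘ suc) g m
  shift-weight : ∀ i → (c ℚ.- ℕ→ℚ (suc i)) ℚ.* f (suc i) ≡ ((c ℚ.- 1ℚ) ℚ.- ℕ→ℚ i) ℚ.* f (suc i)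
  shift-weight i = trans (cong (λ u → (c ℚ.- u) ℚ.* f (suc i)) (ℕ→ℚ-suc i))
    (solve 3 (λ c n a → (c :- (con 1ℚ :+ n)) :* a := ((c :- con 1ℚ) :- n) :* a) refl c (ℕ→ℚ i) (f (suc i)))

derivative-gbinom : ∀ a m → derivative (gbinom a) m ≡ (a ℚ.- ℕ→ℚ m) ℚ.* gbinom a m
derivative-gbinom a m = begin
  N ℚ.* (G ℚ.* ((a ℚ.- M) ℚ.* I))
    ≡⟨ solve 5 (λ N G a M I → N :* (G :* ((a :- M) :* I)) := (N :* I) :* ((a :- M) :* G)) refl N G a M I ⟩
  (N ℚ.* I) ℚ.* ((a ℚ.- M) ℚ.* G)
    ≡⟨ cong (ℚ._* ((a ℚ.- M) ℚ.* G)) (ℕ→ℚ-suc-*-inverse m) ⟩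
  1ℚ ℚ.* ((a ℚ.- M) ℚ.* G)
    ≡⟨ ℚP.*-identityˡ _ ⟩
  (a ℚ.- M) ℚ.* G ∎
  where
  N = ℕ→ℚ (suc m)
  M = ℕ→ℚ m
  G = gbinom a m
  I = (+ 1) / suc m

-- Both sides satisfy (m + 1) V (m + 1) = (a + b - m) V m with V 0 = 1.
gbinom-vandermonde : ∀ a b m → conv (gbinom a) (gbinom b) m ≡ gbinom (a ℚ.+ b) m
gbinom-vandermonde a b zero    = refl
gbinom-vandermonde a b (suc m) = ℕ→ℚ-suc-*-cancelˡ m (begin
  derivative (conv (gbinom a) (gbinom b)) m
    ≡⟨ derivative-conv (gbinom a) (gbinom b) m ⟩
  conv (derivative (gbinom a)) (gbinom b) m ℚ.+ conv (gbinom a) (derivative (gbinom b)) m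
    ≡⟨ cong₂ ℚ._+_ (conv-cong (derivative-gbinom a) (λ _ → refl) m) (conv-cong (λ _ → refl) (derivative-gbinom b) m) ⟩
  conv (λ i → (a ℚ.- ℕ→ℚ i) ℚ.* gbinom a i) (gbinom b) m ℚ.+ conv (gbinom a) (λ j → (b ℚ.- ℕ→ℚ j) ℚ.* gbinom b j) m
    ≡⟨ conv-falling-weights a b (gbinom a) (gbinom b) m ⟩
  (a ℚ.+ b ℚ.- ℕ→ℚ m) ℚ.* conv (gbinom a) (gbinom b) m
    ≡⟨ cong ((a ℚ.+ b ℚ.- ℕ→ℚ m) ℚ.*_) (gbinom-vandermonde a b m) ⟩
  (a ℚ.+ b ℚ.- ℕ→ℚ m) ℚ.* gbinom (a ℚ.+ b) m
    ≡⟨ sym (derivative-gbinom (a ℚ.+ b) m) ⟩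
  derivative (gbinom (a ℚ.+ b)) m ∎)

gbinom-1-≥2 : ∀ k → gbinom 1ℚ (2 ℕ.+ k) ≡ 0ℚ
gbinom-1-≥2 zero    = refl
gbinom-1-≥2 (suc k) = trans (cong (ℚ._* r) (gbinom-1-≥2 k)) (ℚP.*-zeroˡ r)
  where r = (1ℚ ℚ.- ℕ→ℚ (2 ℕ.+ k)) ℚ.* ((+ 1) / (3 ℕ.+ k))

scaledBinomial : ℚ → ℚ → ℕ → ℚ
scaledBinomial c a m = c ^ m ℚ.* gbinom a m

ScaledBinomialsIntegral : ℚ → ℚ → Set
ScaledBinomialsIntegral c a = ∀ m → Integral (scaledBinomial c a m)

conv-scaledBinomial : ∀ c a b m → conv (scaledBinomial c a) (scaledBinomial c b) m ≡ scaledBinomial c (a ℚ.+ b) m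
conv-scaledBinomial c a b m = trans (conv-^ c (gbinom a) (gbinom b) m) (cong (c ^ m ℚ.*_) (gbinom-vandermonde a b m))

scaledBinomial-*ˡ : ∀ d c a m → scaledBinomial (d ℚ.* c) a m ≡ d ^ m ℚ.* scaledBinomial c a m
scaledBinomial-*ˡ d c a m =
  trans (cong (ℚ._* gbinom a m) (^-distrib-* d c m)) (ℚP.*-assoc (d ^ m) (c ^ m) (gbinom a m))

scaledBinomials-+ : ∀ {c a b} → ScaledBinomialsIntegral c a → ScaledBinomialsIntegral c b →
                    ScaledBinomialsIntegral c (a ℚ.+ b)
scaledBinomials-+ {c} {a} {b} sa sb m = subst Integral (conv-scaledBinomial c a b m) (integral-conv sa sb m)

scaledBinomials-* : ∀ {c d a} → Integral d → ScaledBinomialsIntegral c a → ScaledBinomialsIntegral (d ℚ.* c) a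
scaledBinomials-* {c} {d} {a} integral-d sa m =
  subst Integral (sym (scaledBinomial-*ˡ d c a m)) (integral-* (integral-^ integral-d m) (sa m))

module _ {c : ℚ} (integral-c : Integral c) where

  scaledBinomials-1 : ScaledBinomialsIntegral c 1ℚ
  scaledBinomials-1 zero          = integral-ℤ (+ 1)
  scaledBinomials-1 (suc zero)    = integral-* (integral-^ integral-c 1) (integral-ℤ (+ 1))
  scaledBinomials-1 (suc (suc k)) = subst Integral
    (sym (trans (cong (c ^ (2 ℕ.+ k) ℚ.*_) (gbinom-1-≥2 k)) (ℚP.*-zeroʳ (c ^ (2 ℕ.+ k)))))
    (integral-ℤ (+ 0))

  scaledBinomials-+ℕ : ∀ {a} → ScaledBinomialsIntegral c a → ∀ n → ScaledBinomialsIntegral c (ℕ→ℚ n ℚ.+ a)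
  scaledBinomials-+ℕ {a} sa zero    = subst (ScaledBinomialsIntegral c) (sym (ℚP.+-identityˡ a)) sa
  scaledBinomials-+ℕ {a} sa (suc n) = subst (ScaledBinomialsIntegral c)
    (trans (sym (ℚP.+-assoc 1ℚ (ℕ→ℚ n) a)) (cong (ℚ._+ a) (sym (ℕ→ℚ-suc n))))
    (scaledBinomials-+ scaledBinomials-1 (scaledBinomials-+ℕ sa n))

-- The coefficient of index n + 2 of w ⋆ w is 2 wₙ₊₂ plus products of two earlier coefficients,
-- so by induction every wᵢ with i ≥ 1 is even.
integral-square-root : (w : ℕ → ℚ) → w 0 ≡ 1ℚ → MultipleOf two (w 1) →
                       (∀ k → MultipleOf four (conv w w (2 ℕ.+ k))) → ∀ i → Integral (w i)
integral-square-root w w₀≡1 even-w₁ square = integral-w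
  where
  square-split : ∀ n → conv w w (2 ℕ.+ n) ≡ two ℚ.* w (2 ℕ.+ n) ℚ.+ conv (w ∘ suc) (w ∘ suc) n
  square-split n = begin
    w 0 ℚ.* W ℚ.+ conv (w ∘ suc) w (suc n)  ≡⟨ cong₂ (λ u v → u ℚ.* W ℚ.+ v) w₀≡1 (conv-last (w ∘ suc) w n) ⟩
    1ℚ ℚ.* W ℚ.+ (C ℚ.+ W ℚ.* w 0)           ≡⟨ cong (λ u → 1ℚ ℚ.* W ℚ.+ (C ℚ.+ W ℚ.* u)) w₀≡1 ⟩
    1ℚ ℚ.* W ℚ.+ (C ℚ.+ W ℚ.* 1ℚ)            ≡⟨ solve 2 (λ W C → con 1ℚ :* W :+ (C :+ W :* con 1ℚ) := con two :* W :+ C)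
                                                   refl W C ⟩
    two ℚ.* W ℚ.+ C                          ∎
    where
    W = w (2 ℕ.+ n)
    C = conv (w ∘ suc) (w ∘ suc) n

  halve : ∀ {V C D h h′} → D ≡ two ℚ.* V ℚ.+ C → C ≡ four ℚ.* h → D ≡ four ℚ.* h′ → V ≡ two ℚ.* (h′ ℚ.- h)
  halve {V} {C} {D} {h} {h′} D≡2V+C refl D≡4h′ = begin
    V                                      ≡⟨ solve 2 (λ V C → V := con half :* (con two :* V :+ C :- C)) refl V C ⟩
    half ℚ.* (two ℚ.* V ℚ.+ C ℚ.- C)       ≡⟨ cong (λ u → half ℚ.* (u ℚ.- C)) (trans (sym D≡2V+C) D≡4h′) ⟩
    half ℚ.* (four ℚ.* h′ ℚ.- four ℚ.* h)  ≡⟨ solve 2 (λ a b → con half :* (con four :* a :- con four :* b) := con two :* (a :- b))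
                                                 refl h′ h ⟩
    two ℚ.* (h′ ℚ.- h)                     ∎

  even-next : ∀ n → (∀ i → i ≤ n → MultipleOf two (w (suc i))) → MultipleOf two (w (2 ℕ.+ n))
  even-next n even-below with square n | multipleOf-conv {two} {two} n (w ∘ suc) (w ∘ suc) even-below even-below
  ... | h′ , integral-h′ , D≡4h′ | h , integral-h , C≡4h =
    h′ ℚ.- h , integral-sub integral-h′ integral-h , halve {h = h} {h′} (square-split n) C≡4h D≡4h′

  even : ∀ n i → i ≤ n → MultipleOf two (w (suc i))
  even zero    .0 z≤n = even-w₁
  even (suc n) i i≤1+n with ℕP.m≤n⇒m<n∨m≡n i≤1+n
  ... | inj₁ i<1+n = even n i (ℕP.m<1+n⇒m≤n i<1+n)
  ... | inj₂ refl  = even-next n (even n)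

  integral-w : ∀ i → Integral (w i)
  integral-w zero    = subst Integral (sym w₀≡1) (integral-ℤ (+ 1))
  integral-w (suc i) = integral-multipleOf (integral-ℤ (+ 2)) (even i i ℕP.≤-refl)

scaledBinomials-4-½ : ScaledBinomialsIntegral four half
scaledBinomials-4-½ = integral-square-root (scaledBinomial four half) refl (1ℚ , integral-ℤ (+ 1) , refl) square
  where
  square : ∀ k → MultipleOf four (conv (scaledBinomial four half) (scaledBinomial four half) (2 ℕ.+ k))
  square k = 0ℚ , integral-ℤ (+ 0) , (begin
    conv (scaledBinomial four half) (scaledBinomial four half) (2 ℕ.+ k)
      ≡⟨ conv-scaledBinomial four half half (2 ℕ.+ k) ⟩
    four ^ (2 ℕ.+ k) ℚ.* gbinom 1ℚ (2 ℕ.+ k)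
      ≡⟨ cong (four ^ (2 ℕ.+ k) ℚ.*_) (gbinom-1-≥2 k) ⟩
    four ^ (2 ℕ.+ k) ℚ.* 0ℚ
      ≡⟨ trans (ℚP.*-zeroʳ (four ^ (2 ℕ.+ k))) (sym (ℚP.*-zeroʳ four)) ⟩
    four ℚ.* 0ℚ ∎)

scaledBinomials-8-¼ : ScaledBinomialsIntegral eight quarter
scaledBinomials-8-¼ = integral-square-root (scaledBinomial eight quarter) refl (1ℚ , integral-ℤ (+ 1) , refl) square
  where
  square : ∀ k → MultipleOf four (conv (scaledBinomial eight quarter) (scaledBinomial eight quarter) (2 ℕ.+ k))
  square k = two ^ k ℚ.* V , integral-* (integral-^ (integral-ℤ (+ 2)) k) (scaledBinomials-4-½ (2 ℕ.+ k)) , (begin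
    conv (scaledBinomial eight quarter) (scaledBinomial eight quarter) (2 ℕ.+ k)
      ≡⟨ conv-scaledBinomial eight quarter quarter (2 ℕ.+ k) ⟩
    scaledBinomial (two ℚ.* four) half (2 ℕ.+ k)
      ≡⟨ scaledBinomial-*ˡ two four half (2 ℕ.+ k) ⟩
    two ℚ.* (two ℚ.* two ^ k) ℚ.* V
      ≡⟨ solve 2 (λ p v → con two :* (con two :* p) :* v := con four :* (p :* v)) refl (two ^ k) V ⟩
    four ℚ.* (two ^ k ℚ.* V) ∎)
    where V = scaledBinomial four half (2 ℕ.+ k)

scaledBinomials-8-¾ : ScaledBinomialsIntegral eight ((+ 3) / 4)
scaledBinomials-8-¾ = scaledBinomials-+ scaledBinomials-8-¼ (scaledBinomials-* (integral-ℤ (+ 2)) scaledBinomials-4-½)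

integral-scaledCoefficient : ∀ {c a} → ScaledBinomialsIntegral c a → ∀ N m →
                             Integral (gbinom a m ℚ.* ℕ→ℚ N ℚ.* negOnePow m ℚ.* c ^ m)
integral-scaledCoefficient {c} {a} sa N m = subst Integral
  (solve 4 (λ G N s e → (e :* G) :* (N :* s) := G :* N :* s :* e) refl (gbinom a m) (ℕ→ℚ N) (negOnePow m) (c ^ m))
  (integral-* (sa m) (integral-* (integral-ℕ N) (integral-negOnePow m)))

integral-coeffA : ∀ r g m → Integral (coeffA r g m ℚ.* eight ^ m)
integral-coeffA r g m = integral-scaledCoefficient
  (scaledBinomials-+ℕ (integral-ℤ (+ 8)) scaledBinomials-8-¼ (r ∸ g)) ((2 ℕ.* r ∸ g ∸ m) C (r ∸ g)) m

integral-coeffB : ∀ r g m → 1 ≤ r → Integral (coeffB r g m ℚ.* eight ^ m)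
integral-coeffB (suc r) g m _ = integral-scaledCoefficient
  (subst (ScaledBinomialsIntegral eight) ℕ→ℚ-r+¾≡1+r-¼ (scaledBinomials-+ℕ (integral-ℤ (+ 8)) scaledBinomials-8-¾ r))
  ((2 ℕ.* suc r ∸ g ∸ m) C suc r) m
  where
  ℕ→ℚ-r+¾≡1+r-¼ : ℕ→ℚ r ℚ.+ (+ 3) / 4 ≡ ℕ→ℚ (suc r) ℚ.- quarter
  ℕ→ℚ-r+¾≡1+r-¼ = trans (solve 1 (λ n → n :+ con ((+ 3) / 4) := (con 1ℚ :+ n) :- con quarter) refl (ℕ→ℚ r))
                        (cong (ℚ._- quarter) (sym (ℕ→ℚ-suc r)))

IntegralK : K → Set
IntegralK α = Integral (proj₁ α) × Integral (proj₂ α)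

scaleK : ℚ → K → K
scaleK q (a , b) = q ℚ.* a , q ℚ.* b

integralK-scaleK : ∀ {q α} → Integral q → IntegralK α → IntegralK (scaleK q α)
integralK-scaleK iq (ia , ib) = integral-* iq ia , integral-* iq ib

module _ (t : ℕ) where

  private
    T : ℚ
    T = ℕ→ℚ t

  integralK-+ : ∀ {α β} → IntegralK α → IntegralK β → IntegralK (_+K_ t α β)
  integralK-+ (ia , ib) (ic , id) = integral-+ ia ic , integral-+ ib id

  integralK-neg : ∀ {α} → IntegralK α → IntegralK (-K_ t α)
  integralK-neg (ia , ib) = integral-neg ia , integral-neg ib

  integralK-* : ∀ {α β} → IntegralK α → IntegralK β → IntegralK (_*K_ t α β)
  integralK-* (ia , ib) (ic , id) =
    integral-sub (integral-* ia ic) (integral-* (integral-ℕ t) (integral-* ib id)) ,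
    integral-+ (integral-* ia id) (integral-* ib ic)

  integralK-^ : ∀ {α} → IntegralK α → ∀ k → IntegralK (_^K_ t α k)
  integralK-^ iα zero    = integral-ℤ (+ 1) , integral-ℤ (+ 0)
  integralK-^ iα (suc k) = integralK-* iα (integralK-^ iα k)

  integralK-sumK : ∀ n f → (∀ m → IntegralK (f m)) → IntegralK (sumK t n f)
  integralK-sumK zero    f if = if 0
  integralK-sumK (suc n) f if = integralK-+ (integralK-sumK n f if) (if (suc n))

  scaleK-*K : ∀ p q α β → _*K_ t (scaleK p α) (scaleK q β) ≡ scaleK (p ℚ.* q) (_*K_ t α β)
  scaleK-*K p q (a , b) (c , d) = cong₂ _,_
    (solve 7 (λ p q a b c d T → (p :* a) :* (q :* c) :- T :* ((p :* b) :* (q :* d)) := (p :* q) :* (a :* c :- T :* (b :* d)))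
       refl p q a b c d T)
    (solve 6 (λ p q a b c d → (p :* a) :* (q :* d) :+ (p :* b) :* (q :* c) := (p :* q) :* (a :* d :+ b :* c))
       refl p q a b c d)

  scaleK-^K : ∀ q α k → _^K_ t (scaleK q α) k ≡ scaleK (q ^ k) (_^K_ t α k)
  scaleK-^K q α zero    = cong₂ _,_ (sym (ℚP.*-identityˡ 1ℚ)) (sym (ℚP.*-zeroʳ 1ℚ))
  scaleK-^K q α (suc k) = trans (cong (_*K_ t (scaleK q α)) (scaleK-^K q α k)) (scaleK-*K q (q ^ k) α (_^K_ t α k))

  ℚ→K-*K-scaleK : ∀ c q α → _*K_ t (ℚ→K c) (scaleK q α) ≡ scaleK (c ℚ.* q) α
  ℚ→K-*K-scaleK c q (a , b) = cong₂ _,_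
    (solve 5 (λ c q a b T → c :* (q :* a) :- T :* (con 0ℚ :* (q :* b)) := (c :* q) :* a) refl c q a b T)
    (solve 4 (λ c q a b → c :* (q :* b) :+ con 0ℚ :* (q :* a) := (c :* q) :* b) refl c q a b)

  integralK-homog : ∀ {p q X Y} n c → Integral p → (∀ m → Integral (c m ℚ.* q ^ m)) → IntegralK X → IntegralK Y →
                    IntegralK (homog t n c (scaleK p X) (scaleK q Y))
  integralK-homog {p} {q} {X} {Y} n c integral-p integral-cq integral-X integral-Y = integralK-sumK n _ λ m →
    subst IntegralK (sym (monomial-scaling m))
      (integralK-scaleK (integral-* (integral-cq m) (integral-^ integral-p (n ∸ m)))
                        (integralK-* (integralK-^ integral-Y m) (integralK-^ integral-X (n ∸ m))))
    where
    monomial-scaling : ∀ m → _*K_ t (_*K_ t (ℚ→K (c m)) (_^K_ t (scaleK q Y) m)) (_^K_ t (scaleK p X) (n ∸ m))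
                             ≡ scaleK (c m ℚ.* q ^ m ℚ.* p ^ (n ∸ m)) (_*K_ t (_^K_ t Y m) (_^K_ t X (n ∸ m)))
    monomial-scaling m = begin
      _*K_ t (_*K_ t (ℚ→K (c m)) (_^K_ t (scaleK q Y) m)) (_^K_ t (scaleK p X) (n ∸ m))
        ≡⟨ cong₂ (λ u v → _*K_ t (_*K_ t (ℚ→K (c m)) u) v) (scaleK-^K q Y m) (scaleK-^K p X (n ∸ m)) ⟩
      _*K_ t (_*K_ t (ℚ→K (c m)) (scaleK (q ^ m) (_^K_ t Y m))) (scaleK (p ^ (n ∸ m)) (_^K_ t X (n ∸ m)))
        ≡⟨ cong (λ u → _*K_ t u (scaleK (p ^ (n ∸ m)) (_^K_ t X (n ∸ m)))) (ℚ→K-*K-scaleK (c m) (q ^ m) (_^K_ t Y m)) ⟩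
      _*K_ t (scaleK (c m ℚ.* q ^ m) (_^K_ t Y m)) (scaleK (p ^ (n ∸ m)) (_^K_ t X (n ∸ m)))
        ≡⟨ scaleK-*K (c m ℚ.* q ^ m) (p ^ (n ∸ m)) (_^K_ t Y m) (_^K_ t X (n ∸ m)) ⟩
      scaleK (c m ℚ.* q ^ m ℚ.* p ^ (n ∸ m)) (_*K_ t (_^K_ t Y m) (_^K_ t X (n ∸ m))) ∎

  -- z² - 2a z + (a² + t b²) is the characteristic polynomial of a + b√-t.
  characteristicPolynomial-root : ∀ a b c₁ c₂ → c₁ ≡ ℚ.- (two ℚ.* a) → c₂ ≡ a ℚ.* a ℚ.+ T ℚ.* (b ℚ.* b) →
    _+K_ t (_*K_ t (_+K_ t (_*K_ t 1K (a , b)) (c₁ , 0ℚ)) (a , b)) (c₂ , 0ℚ) ≡ 0K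
  characteristicPolynomial-root a b _ _ refl refl = cong₂ _,_
    (solve 3 (λ a b T → ((con 1ℚ :* a :- T :* (con 0ℚ :* b)) :+ :- (con two :* a)) :* a
                        :- T :* ((con 1ℚ :* b :+ con 0ℚ :* a :+ con 0ℚ) :* b) :+ (a :* a :+ T :* (b :* b))
                        := con 0ℚ) refl a b T)
    (solve 3 (λ a b T → ((con 1ℚ :* a :- T :* (con 0ℚ :* b)) :+ :- (con two :* a)) :* b
                        :+ (con 1ℚ :* b :+ con 0ℚ :* a :+ con 0ℚ) :* a :+ con 0ℚ := con 0ℚ) refl a b T)

  algebraicInteger-integralK : ∀ {α} → IntegralK α → IsAlgebraicInteger t α
  algebraicInteger-integralK ((a , refl) , (b , refl)) =
    c₁ ∷ c₂ ∷ [] , characteristicPolynomial-root A B (ℤ→ℚ c₁) (ℤ→ℚ c₂) ℤ→ℚ-c₁ ℤ→ℚ-c₂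
    where
    A = ℤ→ℚ a
    B = ℤ→ℚ b
    c₁ = ℤ.- (+ 2 ℤ.* a)
    c₂ = a ℤ.* a ℤ.+ + t ℤ.* (b ℤ.* b)
    ℤ→ℚ-c₁ : ℤ→ℚ c₁ ≡ ℚ.- (two ℚ.* A)
    ℤ→ℚ-c₁ = trans (ℤ→ℚ-homo-neg (+ 2 ℤ.* a)) (cong ℚ.-_ (ℤ→ℚ-homo-* (+ 2) a))
    ℤ→ℚ-c₂ : ℤ→ℚ c₂ ≡ A ℚ.* A ℚ.+ T ℚ.* (B ℚ.* B)
    ℤ→ℚ-c₂ = trans (ℤ→ℚ-homo-+ (a ℤ.* a) (+ t ℤ.* (b ℤ.* b)))
      (cong₂ ℚ._+_ (ℤ→ℚ-homo-* a a) (trans (ℤ→ℚ-homo-* (+ t) (b ℤ.* b)) (cong (T ℚ.*_) (ℤ→ℚ-homo-* b b))))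

P : ℕ → ℤ → ℤ → ℚ
P t x y = X ℚ.* X ℚ.* X ℚ.* X ℚ.+ four ℚ.* T ℚ.* X ℚ.* X ℚ.* X ℚ.* Y ℚ.- ℤ→ℚ (+ 6) ℚ.* T ℚ.* X ℚ.* X ℚ.* Y ℚ.* Y
          ℚ.- four ℚ.* T ℚ.* T ℚ.* X ℚ.* Y ℚ.* Y ℚ.* Y ℚ.+ T ℚ.* T ℚ.* Y ℚ.* Y ℚ.* Y ℚ.* Y
  where
  X = ℤ→ℚ x
  Y = ℤ→ℚ y
  T = ℕ→ℚ t

integral-P : ∀ t x y → Integral (P t x y)
integral-P t x y =
  integral-+ (integral-sub (integral-sub (integral-+ (X * X * X * X) (I₄ * T * X * X * X * Y)) (I₆ * T * X * X * Y * Y))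
                         (I₄ * T * T * X * Y * Y * Y))
             (T * T * Y * Y * Y * Y)
  where
  infixl 7 _*_
  _*_ : ∀ {p q} → Integral p → Integral q → Integral (p ℚ.* q)
  _*_ = integral-*
  X = integral-ℤ x
  Y = integral-ℤ y
  T = integral-ℕ t
  I₄ = integral-ℤ (+ 4)
  I₆ = integral-ℤ (+ 6)

-- The operations of K on pairs of solver polynomials, so that identities in K can be proved
-- componentwise by the ring solver.
module PolynomialK {n : ℕ} (T : Polynomial n) where

  PK : Set
  PK = Polynomial n × Polynomial n

  infixl 6 _+ₚ_ _-ₚ_
  infixl 7 _*ₚ_

  _+ₚ_ : PK → PK → PK
  (a , b) +ₚ (c , d) = a :+ c , b :+ d

  _-ₚ_ : PK → PK → PK
  (a , b) -ₚ (c , d) = a :+ :- c , b :+ :- d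

  _*ₚ_ : PK → PK → PK
  (a , b) *ₚ (c , d) = a :* c :- T :* (b :* d) , a :* d :+ b :* c

  constₚ : ℚ → PK
  constₚ c = con c , con 0ℚ

  _^ₚ_ : PK → ℕ → PK
  α ^ₚ zero  = constₚ 1ℚ
  α ^ₚ suc k = α *ₚ (α ^ₚ k)

  sₚ : PK
  sₚ = con 0ℚ , con 1ℚ

  module _ (x y : Polynomial n) where

    Wₚ ξ⁴ₚ η⁴ₚ : PK
    Wₚ  = (sₚ +ₚ constₚ 1ℚ) *ₚ (((x , con 0ℚ) -ₚ sₚ *ₚ (y , con 0ℚ)) ^ₚ 4)
    ξ⁴ₚ = constₚ four *ₚ (sₚ +ₚ constₚ 1ℚ) *ₚ (((x , con 0ℚ) -ₚ sₚ *ₚ (y , con 0ℚ)) ^ₚ 4)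
    η⁴ₚ = constₚ four *ₚ (sₚ -ₚ constₚ 1ℚ) *ₚ (((x , con 0ℚ) +ₚ sₚ *ₚ (y , con 0ℚ)) ^ₚ 4)

    Pₚ : Polynomial n
    Pₚ = x :* x :* x :* x :+ con four :* T :* x :* x :* x :* y :- con (ℤ→ℚ (+ 6)) :* T :* x :* x :* y :* y
         :- con four :* T :* T :* x :* y :* y :* y :+ T :* T :* y :* y :* y :* y

module _ (t : ℕ) (x y : ℤ) where

  W : K
  W = _*K_ t (_+K_ t sK 1K) (_^K_ t (_-K_ t (ℤ→K x) (_*K_ t sK (ℤ→K y))) 4)

  integralK-W : IntegralK W
  integralK-W = integralK-* t (integralK-+ t integralK-sK integralK-1K)
    (integralK-^ t (integralK-+ t (integralK-ℤ→K x) (integralK-neg t (integralK-* t integralK-sK (integralK-ℤ→K y)))) 4)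
    where
    integralK-sK : IntegralK sK
    integralK-sK = integral-ℤ (+ 0) , integral-ℤ (+ 1)
    integralK-1K : IntegralK 1K
    integralK-1K = integral-ℤ (+ 1) , integral-ℤ (+ 0)
    integralK-ℤ→K : ∀ z → IntegralK (ℤ→K z)
    integralK-ℤ→K z = integral-ℤ z , integral-ℤ (+ 0)

  ξ⁴≡4W : ξ⁴ t x y ≡ scaleK four W
  ξ⁴≡4W = cong₂ _,_
    (solve 3 (λ a b T → proj₁ (ξ⁴ₚ T a b) := con four :* proj₁ (Wₚ T a b)) refl (ℤ→ℚ x) (ℤ→ℚ y) (ℕ→ℚ t))
    (solve 3 (λ a b T → proj₂ (ξ⁴ₚ T a b) := con four :* proj₂ (Wₚ T a b)) refl (ℤ→ℚ x) (ℤ→ℚ y) (ℕ→ℚ t))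
    where open PolynomialK

  ξ⁴-η⁴≡8P : _-K_ t (ξ⁴ t x y) (η⁴ t x y) ≡ scaleK eight (P t x y , 0ℚ)
  ξ⁴-η⁴≡8P = cong₂ _,_
    (solve 3 (λ a b T → proj₁ (_-ₚ_ T (ξ⁴ₚ T a b) (η⁴ₚ T a b)) := con eight :* Pₚ T a b)
       refl (ℤ→ℚ x) (ℤ→ℚ y) (ℕ→ℚ t))
    (solve 3 (λ a b T → proj₂ (_-ₚ_ T (ξ⁴ₚ T a b) (η⁴ₚ T a b)) := con eight :* con 0ℚ)
       refl (ℤ→ℚ x) (ℤ→ℚ y) (ℕ→ℚ t))
    where open PolynomialK

algebraicInteger-homog-ξ⁴ : ∀ t x y n c → (∀ m → Integral (c m ℚ.* eight ^ m)) →
                            IsAlgebraicInteger t (homog t n c (ξ⁴ t x y) (_-K_ t (ξ⁴ t x y) (η⁴ t x y)))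
algebraicInteger-homog-ξ⁴ t x y n c integral-8ᵐc = subst (IsAlgebraicInteger t)
  (sym (cong₂ (homog t n c) (ξ⁴≡4W t x y) (ξ⁴-η⁴≡8P t x y)))
  (algebraicInteger-integralK t (integralK-homog t n c (integral-ℤ (+ 4)) integral-8ᵐc
    (integralK-W t x y) (integral-P t x y , integral-ℤ (+ 0))))

lemma5p1 : (t r g : ℕ) → 1 ≤ t → 1 ≤ r → g ≤ 1 → (x y : ℤ) →
    IsAlgebraicInteger t (A* t r g (ξ⁴ t x y) (_-K_ t (ξ⁴ t x y) (η⁴ t x y)))
    × IsAlgebraicInteger t (B* t r g (ξ⁴ t x y) (_-K_ t (ξ⁴ t x y) (η⁴ t x y)))
lemma5p1 t r g _ 1≤r _ x y =
  algebraicInteger-homog-ξ⁴ t x y r (coeffA r g) (integral-coeffA r g) ,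
  algebraicInteger-homog-ξ⁴ t x y (r ∸ g) (coeffB r g) (λ m → integral-coeffB r g m 1≤r)
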